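{- Let $d\equiv 5\pmod 6$. There exists a subgroup $H$ of $\mathbb Z_2^2\times\mathbb Z_{4d}$ with $H\cong\mathbb Z_2^3$ and a $(\mathbb Z_2^{2}\times\mathbb Z_{4d},H,3,1)$-difference family.
   Context: Let $(G,+)$ be a finite abelian group and $H$ a subgroup. For a triple $T=\{a,b,c\}$ of three distinct elements of $G$, $\Delta T$ is the multiset $\{\pm(a-b),\pm(a-c),\pm(b-c)\}$, and for a set $\mathcal T$ of triples, $\Delta\mathcal T$ is the multiset union of the $\Delta T$. A $(G,H,3,1)$-difference family is a set $\mathcal T$ of triples of $G$ with $\Delta\mathcal T=G\setminus H$ as multisets (each element of $G\setminus H$ occurs exactly once, elements of $H$ do not occur). -}

module Defs where

open import Data.Nat using (ℕ; zero; suc; _+_; _∸_)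
open import Data.Nat.DivMod using (_mod_)
open import Data.Fin using (Fin; toℕ)
open import Data.Fin.Properties using () renaming (_≟_ to _≟F_)
open import Data.Product using (_×_; _,_; Σ; ∃)
open import Data.List using (List; []; _∷_; _++_; concatMap)
open import Relation.Nullary using (¬_; yes; no; Dec)
open import Data.Product.Properties using (≡-dec)
open import Relation.Binary.PropositionalEquality using (_≡_; _≢_)
open import Function.Definitions using (Injective)

infixl 6 _+ₙ_ _-ₙ_
_+ₙ_ : ∀ {n} → Fin n → Fin n → Fin n
_+ₙ_ {suc k} i j = (toℕ i + toℕ j) mod (suc k)

-ₙ_ : ∀ {n} → Fin n → Fin n
-ₙ_ {suc k} i = (suc k ∸ toℕ i) mod (suc k)

_-ₙ_ : ∀ {n} → Fin n → Fin n → Fin n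
i -ₙ j = i +ₙ (-ₙ j)

G : ℕ → Set
G m = Fin 2 × Fin 2 × Fin m

infixl 6 _+G_ _-G_
_+G_ : ∀ {m} → G m → G m → G m
(a , b , c) +G (a' , b' , c') = (a +ₙ a') , (b +ₙ b') , (c +ₙ c')

_-G_ : ∀ {m} → G m → G m → G m
(a , b , c) -G (a' , b' , c') = (a -ₙ a') , (b -ₙ b') , (c -ₙ c')

_≟G_ : ∀ {m} (x y : G m) → Dec (x ≡ y)
_≟G_ = ≡-dec _≟F_ (≡-dec _≟F_ _≟F_)

count : ∀ {m} → G m → List (G m) → ℕ
count g [] = 0
count g (x ∷ xs) with g ≟G x
... | yes _ = suc (count g xs)
... | no _ = count g xs

Triple : ℕ → Set
Triple m = Σ (G m × G m × G m) λ { (a , b , c) → a ≢ b × a ≢ c × b ≢ c }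

ΔT : ∀ {m} → Triple m → List (G m)
ΔT ((a , b , c) , _) =
  (a -G b) ∷ (b -G a) ∷ (a -G c) ∷ (c -G a) ∷ (b -G c) ∷ (c -G b) ∷ []

Δ : ∀ {m} → List (Triple m) → List (G m)
Δ = concatMap ΔT

Z2³ : Set
Z2³ = Fin 2 × Fin 2 × Fin 2

_+Z2³_ : Z2³ → Z2³ → Z2³
(a , b , c) +Z2³ (a' , b' , c') = (a +ₙ a') , (b +ₙ b') , (c +ₙ c')

-- A subgroup H of G(m) isomorphic to ℤ₂³, given as the image of an injective
-- group homomorphism φ : ℤ₂³ → G(m).
record Z2³Subgroup (m : ℕ) : Set where
  field
    φ     : Z2³ → G m
    hom   : ∀ x y → φ (x +Z2³ y) ≡ φ x +G φ y
    inj   : Injective _≡_ _≡_ φ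

_∈H_ : ∀ {m} → G m → Z2³Subgroup m → Set
g ∈H H = ∃ λ x → Z2³Subgroup.φ H x ≡ g

IsDifferenceFamily : ∀ {m} → Z2³Subgroup m → List (Triple m) → Set
IsDifferenceFamily {m} H 𝒯 =
  (∀ (g : G m) → g ∈H H → count g (Δ 𝒯) ≡ 0) ×
  (∀ (g : G m) → ¬ (g ∈H H) → count g (Δ 𝒯) ≡ 1)

{-# OPTIONS --safe #-}
-- As d ≡ 5 (mod 6), 4d = n = 2h with h = 3k + 4 for k = 4⌊d/6⌋ + 2, and the
-- construction works for every k.  Take H = ℤ₂² × {0, h}.  All triples are
-- {0, (Q, x), (R, y)} with 0 < x < y, whose differences are ±(Q, x), ±(R, y) and
-- ±(R − Q, y − x).  As v ranges once over 1, …, h − 1, the values ±v cover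
-- ℤ_n ∖ {0, h} exactly once, so it suffices that in every class c ∈ ℤ₂² the
-- "base differences" x, y, y − x of class c are exactly 1, …, h − 1.  The triples
-- are taken in six families where x runs with step 2, y with step 1 and y − x
-- with step −1; in each class the contributed values are consecutive blocks
-- (two step-2 progressions interleaving into one block) that tile [1, h).
module Submission where

open import Data.Bool using (if_then_else_)
open import Data.Fin using (Fin; zero; suc; toℕ; fromℕ<)
open import Data.Fin.Properties using (toℕ-fromℕ<; toℕ-injective; toℕ<n) renaming (_≟_ to _≟F_)
open import Data.List using (List; []; _∷_; _++_; map; concatMap)
open import Data.List.Properties using (map-++)
open import Data.Nat
open import Data.Nat.DivMod using (%-distribˡ-+; [m+n]%n≡m%n; m<n⇒m%n≡m; n%n≡0; m≡m%n+[m/n]*n)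
open import Data.Nat.ListAction using (sum)
open import Data.Nat.ListAction.Properties using (sum-++)
open import Data.Nat.Properties
open import Algebra.Properties.CommutativeSemigroup +-commutativeSemigroup using (interchange)
open import Data.Nat.Tactic.RingSolver using (solve-∀; solve)
open import Data.Product using (Σ; _×_; _,_)
open import Data.Product.Properties using (≡-dec)
open import Function using (_∘_)
open import Function.Bundles using (mk⇔)
open import Function.Definitions using (Injective)
open import Relation.Binary.Definitions using (DecidableEquality; tri<; tri≈; tri>)
open import Relation.Binary.PropositionalEquality
open import Relation.Nullary using (Dec; yes; no; does; ¬_; contradiction)
open import Relation.Nullary.Decidable using (does-⇔)

open import Defs

module _ {m : ℕ} where
  private
    n : ℕ
    n = suc m

  toℕ-+ₙ : (i j : Fin n) → toℕ (i +ₙ j) ≡ (toℕ i + toℕ j) % n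
  toℕ-+ₙ i j = toℕ-fromℕ< _

  toℕ-[-ₙ] : (i j : Fin n) → toℕ (i -ₙ j) ≡ (toℕ i + (n ∸ toℕ j)) % n
  toℕ-[-ₙ] i j = begin
    toℕ (i -ₙ j)                            ≡⟨ toℕ-+ₙ i (-ₙ j) ⟩
    (toℕ i + toℕ (-ₙ j)) % n                 ≡⟨ cong (λ t → (toℕ i + t) % n) (toℕ-fromℕ< _) ⟩
    (toℕ i + (n ∸ toℕ j) % n) % n            ≡⟨ cong (λ t → (t + (n ∸ toℕ j) % n) % n) (m<n⇒m%n≡m (toℕ<n i)) ⟨
    (toℕ i % n + (n ∸ toℕ j) % n) % n        ≡⟨ %-distribˡ-+ (toℕ i) (n ∸ toℕ j) n ⟨
    (toℕ i + (n ∸ toℕ j)) % n                ∎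
    where open ≡-Reasoning

  toℕ-[-ₙ]-≤ : (i j : Fin n) → toℕ j ≤ toℕ i → toℕ (i -ₙ j) ≡ toℕ i ∸ toℕ j
  toℕ-[-ₙ]-≤ i j j≤i = begin
    toℕ (i -ₙ j)                  ≡⟨ toℕ-[-ₙ] i j ⟩
    (toℕ i + (n ∸ toℕ j)) % n     ≡⟨ cong (_% n) (+-∸-assoc (toℕ i) (<⇒≤ (toℕ<n j))) ⟨
    (toℕ i + n ∸ toℕ j) % n       ≡⟨ cong (_% n) (+-∸-comm n j≤i) ⟩
    (toℕ i ∸ toℕ j + n) % n       ≡⟨ [m+n]%n≡m%n (toℕ i ∸ toℕ j) n ⟩
    (toℕ i ∸ toℕ j) % n           ≡⟨ m<n⇒m%n≡m (≤-<-trans (m∸n≤m (toℕ i) (toℕ j)) (toℕ<n i)) ⟩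
    toℕ i ∸ toℕ j                 ∎
    where open ≡-Reasoning

  toℕ-[-ₙ]-< : (i j : Fin n) → toℕ i < toℕ j → toℕ (i -ₙ j) ≡ n ∸ (toℕ j ∸ toℕ i)
  toℕ-[-ₙ]-< i j i<j = begin
    toℕ (i -ₙ j)                  ≡⟨ toℕ-[-ₙ] i j ⟩
    (toℕ i + (n ∸ toℕ j)) % n     ≡⟨ cong (_% n) wraps ⟩
    (n ∸ (toℕ j ∸ toℕ i)) % n     ≡⟨ m<n⇒m%n≡m (∸-monoʳ-< (m<n⇒0<n∸m i<j) j∸i≤n) ⟩
    n ∸ (toℕ j ∸ toℕ i)           ∎
    where
    open ≡-Reasoning
    j∸i≤n : toℕ j ∸ toℕ i ≤ n
    j∸i≤n = ≤-trans (m∸n≤m (toℕ j) (toℕ i)) (<⇒≤ (toℕ<n j))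
    wraps : toℕ i + (n ∸ toℕ j) ≡ n ∸ (toℕ j ∸ toℕ i)
    wraps = begin
      toℕ i + (n ∸ toℕ j)                                     ≡⟨ m+n∸n≡m _ (toℕ j ∸ toℕ i) ⟨
      toℕ i + (n ∸ toℕ j) + (toℕ j ∸ toℕ i) ∸ (toℕ j ∸ toℕ i) ≡⟨ cong (_∸ (toℕ j ∸ toℕ i)) total ⟩
      n ∸ (toℕ j ∸ toℕ i)                                     ∎
      where
      total : toℕ i + (n ∸ toℕ j) + (toℕ j ∸ toℕ i) ≡ n
      total = begin
        toℕ i + (n ∸ toℕ j) + (toℕ j ∸ toℕ i)   ≡⟨ cong (_+ (toℕ j ∸ toℕ i)) (+-comm (toℕ i) _) ⟩
        n ∸ toℕ j + toℕ i + (toℕ j ∸ toℕ i)     ≡⟨ +-assoc (n ∸ toℕ j) _ _ ⟩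
        n ∸ toℕ j + (toℕ i + (toℕ j ∸ toℕ i))   ≡⟨ cong (n ∸ toℕ j +_) (m+[n∸m]≡n (<⇒≤ i<j)) ⟩
        n ∸ toℕ j + toℕ j                       ≡⟨ m∸n+n≡m (<⇒≤ (toℕ<n j)) ⟩
        n                                       ∎

  -ₙ-identityʳ : (i : Fin n) → i -ₙ zero ≡ i
  -ₙ-identityʳ i = toℕ-injective (toℕ-[-ₙ]-≤ i zero z≤n)

when : ∀ {p} {P : Set p} → Dec P → ℕ → ℕ
when P? x = if does P? then x else 0

when-yes : ∀ {p} {P : Set p} (P? : Dec P) {x} → P → when P? x ≡ x
when-yes (yes _) _ = refl
when-yes (no ¬p) p = contradiction p ¬p

when-no : ∀ {p} {P : Set p} (P? : Dec P) {x} → ¬ P → when P? x ≡ 0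
when-no (yes p) ¬p = contradiction p ¬p
when-no (no _)  _  = refl

when-+ : ∀ {p} {P : Set p} (P? : Dec P) x y → when P? (x + y) ≡ when P? x + when P? y
when-+ (yes _) x y = refl
when-+ (no _)  x y = refl

when-0 : ∀ {p} {P : Set p} (P? : Dec P) → when P? 0 ≡ 0
when-0 (yes _) = refl
when-0 (no _)  = refl

δ : ℕ → ℕ → ℕ
δ v w = when (v ≟ w) 1

δ-refl : ∀ v → δ v v ≡ 1
δ-refl v = when-yes (v ≟ v) refl

δ-≢ : ∀ {v w} → v ≢ w → δ v w ≡ 0
δ-≢ {v} {w} = when-no (v ≟ w)

δ-∸-swap : ∀ {n v w} → v ≤ n → w ≤ n → δ v (n ∸ w) ≡ δ (n ∸ v) w
δ-∸-swap {n} {v} {w} v≤n w≤n =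
  cong (if_then 1 else 0) (does-⇔ (mk⇔ to from) (v ≟ n ∸ w) (n ∸ v ≟ w))
  where
  to : v ≡ n ∸ w → n ∸ v ≡ w
  to refl = m∸[m∸n]≡n w≤n
  from : n ∸ v ≡ w → v ≡ n ∸ w
  from refl = sym (m∸[m∸n]≡n v≤n)

hits : (ℕ → ℕ) → ℕ → ℕ → ℕ
hits f zero    v = 0
hits f (suc L) v = hits f L v + δ v (f L)

-- Opaque, so that unification never unfolds a run: the chains of ∪⟨_⟩ below
-- recover each start and length from the terms alone.
opaque
  run : ℕ → ℕ → ℕ → ℕ
  run a = hits (a +_)

opaque
  unfolding run

  run-zero : ∀ a v → run a 0 v ≡ 0
  run-zero a v = refl

  run-suc : ∀ a L v → run a (suc L) v ≡ run a L v + δ v (a + L)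
  run-suc a L v = refl

  hits-1 : ∀ f v → hits f 1 v ≡ run (f 0) 1 v
  hits-1 f v = cong (λ u → 0 + δ v u) (sym (+-identityʳ (f 0)))

  run-++ : ∀ a L M v → run a L v + run (a + L) M v ≡ run a (L + M) v
  run-++ a L zero    v = trans (+-identityʳ _) (cong (λ t → run a t v) (sym (+-identityʳ L)))
  run-++ a L (suc M) v = begin
    run a L v + (run (a + L) M v + δ v (a + L + M))   ≡⟨ +-assoc (run a L v) _ _ ⟨
    run a L v + run (a + L) M v + δ v (a + L + M)     ≡⟨ cong₂ _+_ (run-++ a L M v) (cong (δ v) (+-assoc a L M)) ⟩
    run a (suc (L + M)) v                             ≡⟨ cong (λ t → run a t v) (+-suc L M) ⟨
    run a (L + suc M) v                               ∎
    where open ≡-Reasoning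

  run-∉ˡ : ∀ {a v} L → v < a → run a L v ≡ 0
  run-∉ˡ zero    v<a = refl
  run-∉ˡ {a} (suc L) v<a =
    cong₂ _+_ (run-∉ˡ L v<a) (δ-≢ (<⇒≢ (<-≤-trans v<a (m≤m+n a L))))

  run-∉ʳ : ∀ {a v} L → a + L ≤ v → run a L v ≡ 0
  run-∉ʳ zero    _ = refl
  run-∉ʳ {a} {v} (suc L) a+L<v rewrite +-suc a L =
    cong₂ _+_ (run-∉ʳ L (<⇒≤ a+L<v)) (δ-≢ (≢-sym (<⇒≢ a+L<v)))

  run-∈ : ∀ {a v} L → a ≤ v → v < a + L → run a L v ≡ 1
  run-∈ {a} {v} zero a≤v v<a+0 = contradiction (subst (v <_) (+-identityʳ a) v<a+0) (≤⇒≯ a≤v)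
  run-∈ {a} {v} (suc L) a≤v v<a+1+L with v ≟ a + L
  ... | yes refl = trans (cong (_+ δ v v) (run-∉ʳ L ≤-refl)) (δ-refl v)
  ... | no v≢a+L = cong₂ _+_ (run-∈ L a≤v v<a+L) (δ-≢ v≢a+L)
    where
    v<a+L : v < a + L
    v<a+L = ≤∧≢⇒< (s≤s⁻¹ (subst (v <_) (+-suc a L) v<a+1+L)) v≢a+L

  hits-interleave : ∀ a L v →
    hits (λ i → suc a + 2 * i) L v + hits (λ i → a + 2 * i) (suc L) v ≡ run a (suc (2 * L)) v
  hits-interleave a zero    v = refl
  hits-interleave a (suc L) v = begin
    (odd L + δ v (suc a + 2 * L)) + (even (suc L) + δ v (a + 2 * suc L))
      ≡⟨ interchange (odd L) _ _ _ ⟩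
    (odd L + even (suc L)) + (δ v (suc a + 2 * L) + δ v (a + 2 * suc L))
      ≡⟨ cong₂ _+_ (hits-interleave a L v)
                   (cong₂ _+_ (cong (δ v) (solve (a ∷ L ∷ []))) (cong (δ v) (solve (a ∷ L ∷ [])))) ⟩
    run a (suc (2 * L)) v + run (a + suc (2 * L)) 2 v
      ≡⟨ run-++ a (suc (2 * L)) 2 v ⟩
    run a (suc (2 * L) + 2) v
      ≡⟨ cong (λ t → run a t v) (solve (L ∷ [])) ⟩
    run a (suc (2 * suc L)) v ∎
    where
    open ≡-Reasoning
    odd even : ℕ → ℕ
    odd  L = hits (λ i → suc a + 2 * i) L v
    even L = hits (λ i → a + 2 * i) L v

  hits-descending : ∀ c L v → hits ((c + L) ∸_) L v ≡ run (suc c) L v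
  hits-descending c zero    v = refl
  hits-descending c (suc L) v = begin
    hits ((c + suc L) ∸_) L v + δ v (c + suc L ∸ L)
      ≡⟨ cong₂ (λ t u → hits (t ∸_) L v + δ v u) (+-suc c L) top ⟩
    hits ((suc c + L) ∸_) L v + δ v (suc c + 0)
      ≡⟨ cong (_+ δ v (suc c + 0)) (hits-descending (suc c) L v) ⟩
    run (suc (suc c)) L v + run (suc c) 1 v
      ≡⟨ cong₂ _+_ (cong (λ t → run t L v) (+-comm 1 (suc c))) refl ⟩
    run (suc c + 1) L v + run (suc c) 1 v
      ≡⟨ +-comm (run (suc c + 1) L v) _ ⟩
    run (suc c) 1 v + run (suc c + 1) L v
      ≡⟨ run-++ (suc c) 1 L v ⟩
    run (suc c) (suc L) v ∎
    where
    open ≡-Reasoning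
    top : c + suc L ∸ L ≡ suc c + 0
    top = trans (cong (_∸ L) (+-suc c L)) (trans (m+n∸n≡m (suc c) L) (sym (+-identityʳ (suc c))))

join-runs : ∀ {x y a b L M v} → x ≡ run a L v → y ≡ run b M v → a + L ≡ b → x + y ≡ run a (L + M) v
join-runs {a = a} {L = L} {M} {v} refl refl refl = run-++ a L M v

-- The side condition is the last argument, so that both runs are known when
-- the ring solver is run on it.
infixl 6 join-runs
syntax join-runs p q e = p ∪⟨ e ⟩ q

+-interchange₃ : ∀ a a′ b b′ c c′ → (a + a′) + ((b + b′) + (c + c′)) ≡ (a + (b + c)) + (a′ + (b′ + c′))
+-interchange₃ a a′ b b′ c c′ =
  trans (cong ((a + a′) +_) (interchange b b′ c c′)) (interchange a a′ (b + c) (b′ + c′))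

sum-map-++ : ∀ {a} {A : Set a} (f : A → ℕ) xs ys → sum (map f (xs ++ ys)) ≡ sum (map f xs) + sum (map f ys)
sum-map-++ f xs ys = trans (cong sum (map-++ f xs ys)) (sum-++ (map f xs) (map f ys))

progression-x<y : ∀ a b i → i < b → a + 2 * i < a + b + i
progression-x<y a b i i<b = begin-strict
  a + 2 * i   ≡⟨ solve (a ∷ i ∷ []) ⟩
  a + i + i   <⟨ +-monoʳ-< (a + i) i<b ⟩
  a + i + b   ≡⟨ solve (a ∷ b ∷ i ∷ []) ⟩
  a + b + i   ∎
  where open ≤-Reasoning

progression-y∸x : ∀ a b i → a + b + i ∸ (a + 2 * i) ≡ b ∸ i
progression-y∸x a b i = begin
  a + b + i ∸ (a + 2 * i)   ≡⟨ cong₂ _∸_ (y≡ a b i) (x≡ a i) ⟩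
  a + i + b ∸ (a + i + i)   ≡⟨ [m+n]∸[m+o]≡n∸o (a + i) b i ⟩
  b ∸ i                     ∎
  where
  open ≡-Reasoning
  y≡ : ∀ a b i → a + b + i ≡ a + i + b
  y≡ = solve-∀
  x≡ : ∀ a i → a + 2 * i ≡ a + i + i
  x≡ = solve-∀

Class : Set
Class = Fin 2 × Fin 2

0ᶜ : Class
0ᶜ = zero , zero

infixl 6 _⊖_
_⊖_ : Class → Class → Class
(p , q) ⊖ (p′ , q′) = p -ₙ p′ , q -ₙ q′

infix 4 _≟ᶜ_
_≟ᶜ_ : DecidableEquality Class
_≟ᶜ_ = ≡-dec _≟F_ _≟F_

⟨_,_⟩ : ∀ {m} → Class → Fin m → G m
⟨ (p , q) , z ⟩ = p , q , z

ℤ₂-comm : (p q : Fin 2) → p -ₙ q ≡ q -ₙ p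
ℤ₂-comm zero       zero       = refl
ℤ₂-comm zero       (suc zero) = refl
ℤ₂-comm (suc zero) zero       = refl
ℤ₂-comm (suc zero) (suc zero) = refl

⊖-identityʳ : ∀ e → e ⊖ 0ᶜ ≡ e
⊖-identityʳ (p , q) = cong₂ _,_ (-ₙ-identityʳ p) (-ₙ-identityʳ q)

⊖-comm : ∀ e e′ → e ⊖ e′ ≡ e′ ⊖ e
⊖-comm (p , q) (p′ , q′) = cong₂ _,_ (ℤ₂-comm p p′) (ℤ₂-comm q q′)

classSum : Class → List (Class × (ℕ → ℕ)) → ℕ → ℕ
classSum c ps v = sum (map (λ (e , f) → when (c ≟ᶜ e) (f v)) ps)

count-++ : ∀ {m} (g : G m) xs ys → count g (xs ++ ys) ≡ count g xs + count g ys
count-++ g []       ys = refl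
count-++ g (x ∷ xs) ys with g ≟G x
... | yes _ = cong suc (count-++ g xs ys)
... | no  _ = count-++ g xs ys

count-⟨⟩ : ∀ {m} c e (z w : Fin m) → count ⟨ c , z ⟩ (⟨ e , w ⟩ ∷ []) ≡ when (c ≟ᶜ e) (δ (toℕ z) (toℕ w))
count-⟨⟩ (p , q) (p′ , q′) z w with (p , q , z) ≟G (p′ , q′ , w)
... | yes refl = sym (trans (when-yes ((p , q) ≟ᶜ (p , q)) refl) (δ-refl (toℕ z)))
... | no g≢e with (p , q) ≟ᶜ (p′ , q′)
...   | yes refl = sym (δ-≢ (g≢e ∘ cong (λ u → p , q , u) ∘ toℕ-injective))
...   | no  _    = refl

record BaseTriple (n : ℕ) : Set where
  field
    Q R : Class
    x y : ℕ
    0<x : 0 < x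
    x<y : x < y
    y<n : y < n

  X Y : Fin n
  X = fromℕ< (<-trans x<y y<n)
  Y = fromℕ< y<n

  toℕ-X : toℕ X ≡ x
  toℕ-X = toℕ-fromℕ< _

  toℕ-Y : toℕ Y ≡ y
  toℕ-Y = toℕ-fromℕ< _

  0<X : 0 < toℕ X
  0<X = subst (0 <_) (sym toℕ-X) 0<x

  X<Y : toℕ X < toℕ Y
  X<Y = subst₂ _<_ (sym toℕ-X) (sym toℕ-Y) x<y

progressionPieces : (Q R : Class) (a b L : ℕ) → List (Class × (ℕ → ℕ))
progressionPieces Q R a b L =
  (Q , hits (λ i → a + 2 * i) L) ∷ (R , run (a + b) L) ∷ (R ⊖ Q , hits (b ∸_) L) ∷ []

record Family (n : ℕ) : Set where
  field
    Q R     : Class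
    a b L   : ℕ
    0<a     : 0 < a
    L≤b     : L ≤ b
    bounded : a + b + L ≤ n

  pieces : List (Class × (ℕ → ℕ))
  pieces = progressionPieces Q R a b L

open Family using (pieces)

diffPair : ∀ {m} → G m → G m → List (G m)
diffPair g₁ g₂ = g₁ -G g₂ ∷ g₂ -G g₁ ∷ []

module _ {m : ℕ} where
  private
    n : ℕ
    n = suc m

  ⟨⟩-apart : ∀ {c e} {z w : Fin n} → toℕ z < toℕ w → ⟨ c , z ⟩ ≢ ⟨ e , w ⟩
  ⟨⟩-apart z<w eq = <⇒≢ z<w (cong (λ (_ , _ , u) → toℕ u) eq)

  triple : BaseTriple n → Triple n
  triple t =
    (⟨ 0ᶜ , zero ⟩ , ⟨ Q , X ⟩ , ⟨ R , Y ⟩) , ⟨⟩-apart 0<X , ⟨⟩-apart (<-trans 0<X X<Y) , ⟨⟩-apart X<Y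
    where open BaseTriple t

  -- The differences of triple t are ± its base differences x, y, y − x, of
  -- classes Q, R, R ⊖ Q.
  μ : BaseTriple n → Class → ℕ → ℕ
  μ t c v = when (c ≟ᶜ Q) (δ v x) + (when (c ≟ᶜ R) (δ v y) + when (c ≟ᶜ R ⊖ Q) (δ v (y ∸ x)))
    where open BaseTriple t

  count-diffPair : ∀ c z e e′ {d w} {i j : Fin n} → toℕ i < toℕ j → e′ ⊖ e ≡ d → toℕ j ∸ toℕ i ≡ w →
    count ⟨ c , z ⟩ (diffPair ⟨ e , i ⟩ ⟨ e′ , j ⟩)
      ≡ when (c ≟ᶜ d) (δ (toℕ z) w) + when (c ≟ᶜ d) (δ (n ∸ toℕ z) w)
  count-diffPair c z e e′ {i = i} {j} i<j refl refl = begin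
    count g (diffPair ⟨ e , i ⟩ ⟨ e′ , j ⟩)
      ≡⟨ count-++ g (⟨ e ⊖ e′ , i -ₙ j ⟩ ∷ []) (⟨ e′ ⊖ e , j -ₙ i ⟩ ∷ []) ⟩
    count g (⟨ e ⊖ e′ , i -ₙ j ⟩ ∷ []) + count g (⟨ e′ ⊖ e , j -ₙ i ⟩ ∷ [])
      ≡⟨ cong₂ _+_ (count-⟨⟩ c (e ⊖ e′) z (i -ₙ j)) (count-⟨⟩ c (e′ ⊖ e) z (j -ₙ i)) ⟩
    [e⊖e′] (δ (toℕ z) (toℕ (i -ₙ j))) + [e′⊖e] (δ (toℕ z) (toℕ (j -ₙ i)))
      ≡⟨ cong₂ _+_ (cong₂ (λ d u → when (c ≟ᶜ d) (δ (toℕ z) u)) (⊖-comm e e′) (toℕ-[-ₙ]-< i j i<j))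
                   (cong ([e′⊖e] ∘ δ (toℕ z)) (toℕ-[-ₙ]-≤ j i (<⇒≤ i<j))) ⟩
    [e′⊖e] (δ (toℕ z) (n ∸ w)) + [e′⊖e] (δ (toℕ z) w)
      ≡⟨ cong (λ u → [e′⊖e] u + [e′⊖e] (δ (toℕ z) w)) (δ-∸-swap (<⇒≤ (toℕ<n z)) w≤n) ⟩
    [e′⊖e] (δ (n ∸ toℕ z) w) + [e′⊖e] (δ (toℕ z) w)
      ≡⟨ +-comm ([e′⊖e] (δ (n ∸ toℕ z) w)) _ ⟩
    [e′⊖e] (δ (toℕ z) w) + [e′⊖e] (δ (n ∸ toℕ z) w) ∎
    where
    open ≡-Reasoning
    g = ⟨ c , z ⟩
    [e⊖e′] [e′⊖e] : ℕ → ℕ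
    [e⊖e′] = when (c ≟ᶜ e ⊖ e′)
    [e′⊖e] = when (c ≟ᶜ e′ ⊖ e)
    w = toℕ j ∸ toℕ i
    w≤n : w ≤ n
    w≤n = ≤-trans (m∸n≤m (toℕ j) (toℕ i)) (<⇒≤ (toℕ<n j))

  count-ΔT : ∀ t c (z : Fin n) → count ⟨ c , z ⟩ (ΔT (triple t)) ≡ μ t c (toℕ z) + μ t c (n ∸ toℕ z)
  count-ΔT t c z = begin
    count g (diffPair O A ++ (diffPair O B ++ diffPair A B))
      ≡⟨ count-++ g (diffPair O A) _ ⟩
    count g (diffPair O A) + count g (diffPair O B ++ diffPair A B)
      ≡⟨ cong (count g (diffPair O A) +_) (count-++ g (diffPair O B) _) ⟩
    count g (diffPair O A) + (count g (diffPair O B) + count g (diffPair A B))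
      ≡⟨ cong₂ _+_ (count-diffPair c z 0ᶜ Q 0<X (⊖-identityʳ Q) toℕ-X)
           (cong₂ _+_ (count-diffPair c z 0ᶜ R (<-trans 0<X X<Y) (⊖-identityʳ R) toℕ-Y)
                      (count-diffPair c z Q R X<Y refl (cong₂ _∸_ toℕ-Y toℕ-X))) ⟩
    pair Q x + (pair R y + pair (R ⊖ Q) (y ∸ x))
      ≡⟨ +-interchange₃ (at Q x v) (at Q x v′) (at R y v) (at R y v′)
                        (at (R ⊖ Q) (y ∸ x) v) (at (R ⊖ Q) (y ∸ x) v′) ⟩
    μ t c v + μ t c v′ ∎
    where
    open ≡-Reasoning
    open BaseTriple t
    g = ⟨ c , z ⟩
    O = ⟨ 0ᶜ , zero ⟩
    A = ⟨ Q , X ⟩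
    B = ⟨ R , Y ⟩
    v v′ : ℕ
    v  = toℕ z
    v′ = n ∸ toℕ z
    at : Class → ℕ → ℕ → ℕ
    at d w u = when (c ≟ᶜ d) (δ u w)
    pair : Class → ℕ → ℕ
    pair d w = at d w v + at d w v′

  mult : List (BaseTriple n) → Class → ℕ → ℕ
  mult ts c v = sum (map (λ t → μ t c v) ts)

  count-Δ : ∀ ts c (z : Fin n) → count ⟨ c , z ⟩ (Δ (map triple ts)) ≡ mult ts c (toℕ z) + mult ts c (n ∸ toℕ z)
  count-Δ []       c z = refl
  count-Δ (t ∷ ts) c z = begin
    count g (ΔT (triple t) ++ Δ (map triple ts))
      ≡⟨ count-++ g (ΔT (triple t)) _ ⟩
    count g (ΔT (triple t)) + count g (Δ (map triple ts))
      ≡⟨ cong₂ _+_ (count-ΔT t c z) (count-Δ ts c z) ⟩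
    (μ t c (toℕ z) + μ t c (n ∸ toℕ z)) + (mult ts c (toℕ z) + mult ts c (n ∸ toℕ z))
      ≡⟨ interchange (μ t c (toℕ z)) _ _ _ ⟩
    mult (t ∷ ts) c (toℕ z) + mult (t ∷ ts) c (n ∸ toℕ z) ∎
    where
    open ≡-Reasoning
    g = ⟨ c , z ⟩

  progression : (Q R : Class) (a b : ℕ) → 0 < a → ∀ L → L ≤ b → a + b + L ≤ n → List (BaseTriple n)
  progression Q R a b 0<a zero    _   _     = []
  progression Q R a b 0<a (suc i) i<b bound = t ∷ progression Q R a b 0<a i (<⇒≤ i<b) (<⇒≤ y<n)
    where
    y<n : a + b + i < n
    y<n = subst (_≤ n) (+-suc (a + b) i) bound
    t : BaseTriple n
    t = record
      { Q = Q ; R = R ; x = a + 2 * i ; y = a + b + i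
      ; 0<x = <-≤-trans 0<a (m≤m+n a (2 * i)) ; x<y = progression-x<y a b i i<b ; y<n = y<n }

  mult-progression : ∀ Q R a b 0<a L L≤b bound c v →
    mult (progression Q R a b 0<a L L≤b bound) c v ≡ classSum c (progressionPieces Q R a b L) v
  mult-progression Q R a b 0<a zero L≤b bound c v =
    sym (cong₂ _+_ (when-0 (c ≟ᶜ Q))
           (cong₂ _+_ (trans (cong (when (c ≟ᶜ R)) (run-zero (a + b) v)) (when-0 (c ≟ᶜ R)))
                      (cong (_+ 0) (when-0 (c ≟ᶜ R ⊖ Q)))))
  mult-progression Q R a b 0<a (suc i) i<b bound c v = begin
    newest + mult (progression Q R a b 0<a i (<⇒≤ i<b) _) c v
      ≡⟨ cong (newest +_) (mult-progression Q R a b 0<a i (<⇒≤ i<b) _ c v) ⟩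
    newest + ([Q] (Hx i) + ([R] (Hy i) + ([R⊖Q] (Hd i) + 0)))
      ≡⟨ shuffle ([Q] (δ v x)) ([R] (δ v y)) ([R⊖Q] (δ v (y ∸ x))) ([Q] (Hx i)) ([R] (Hy i)) ([R⊖Q] (Hd i)) ⟩
    ([Q] (Hx i) + [Q] (δ v x)) + (([R] (Hy i) + [R] (δ v y)) + (([R⊖Q] (Hd i) + [R⊖Q] (δ v (y ∸ x))) + 0))
      ≡⟨ cong₂ _+_ (when-+ (c ≟ᶜ Q) _ _)
           (cong₂ _+_ (trans (cong [R] (run-suc (a + b) i v)) (when-+ (c ≟ᶜ R) _ _))
                      (cong (_+ 0) (trans (cong (λ u → [R⊖Q] (Hd i + δ v u)) (sym (progression-y∸x a b i)))
                                          (when-+ (c ≟ᶜ R ⊖ Q) _ _)))) ⟨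
    [Q] (Hx (suc i)) + ([R] (Hy (suc i)) + ([R⊖Q] (Hd (suc i)) + 0)) ∎
    where
    open ≡-Reasoning
    x = a + 2 * i
    y = a + b + i
    [Q] [R] [R⊖Q] : ℕ → ℕ
    [Q]   = when (c ≟ᶜ Q)
    [R]   = when (c ≟ᶜ R)
    [R⊖Q] = when (c ≟ᶜ R ⊖ Q)
    newest = [Q] (δ v x) + ([R] (δ v y) + [R⊖Q] (δ v (y ∸ x)))
    Hx Hy Hd : ℕ → ℕ
    Hx L = hits (λ i → a + 2 * i) L v
    Hy L = run (a + b) L v
    Hd L = hits (b ∸_) L v
    shuffle : ∀ p q r P Q R → (p + (q + r)) + (P + (Q + (R + 0))) ≡ (P + p) + ((Q + q) + ((R + r) + 0))
    shuffle = solve-∀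

  triples : Family n → List (BaseTriple n)
  triples F = progression Q R a b 0<a L L≤b bounded
    where open Family F

  mult-concatMap : ∀ Fs c v → mult (concatMap triples Fs) c v ≡ classSum c (concatMap pieces Fs) v
  mult-concatMap []       c v = refl
  mult-concatMap (F ∷ Fs) c v = begin
    mult (triples F ++ concatMap triples Fs) c v
      ≡⟨ sum-map-++ (λ t → μ t c v) (triples F) (concatMap triples Fs) ⟩
    mult (triples F) c v + mult (concatMap triples Fs) c v
      ≡⟨ cong₂ _+_ (mult-progression Q R a b 0<a L L≤b bounded c v) (mult-concatMap Fs c v) ⟩
    classSum c (pieces F) v + classSum c (concatMap pieces Fs) v
      ≡⟨ sum-map-++ (λ (e , f) → when (c ≟ᶜ e) (f v)) (pieces F) (concatMap pieces Fs) ⟨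
    classSum c (pieces F ++ concatMap pieces Fs) v ∎
    where
    open ≡-Reasoning
    open Family F hiding (pieces)

HasDifferenceFamily : ℕ → Set
HasDifferenceFamily n = Σ (Z2³Subgroup n) λ H → Σ (List (Triple n)) λ 𝒯 → IsDifferenceFamily H 𝒯

module HalfTiling (h-1 : ℕ) where
  h n : ℕ
  h = suc h-1
  n = h + h

  h<n : h < n
  h<n = m<m+n h z<s

  halfRange : ℕ → ℕ
  halfRange = run 1 h-1

  n∸h≡h : n ∸ h ≡ h
  n∸h≡h = m+n∸n≡m h h

  half : Fin n
  half = fromℕ< h<n

  toℕ-half : toℕ half ≡ h
  toℕ-half = toℕ-fromℕ< h<n

  embed : Fin 2 → Fin n
  embed zero       = zero
  embed (suc zero) = half

  embed-hom : ∀ p q → embed (p +ₙ q) ≡ embed p +ₙ embed q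
  embed-hom zero       zero       = refl
  embed-hom zero       (suc zero) = toℕ-injective (sym (trans (toℕ-+ₙ zero half) (m<n⇒m%n≡m (toℕ<n half))))
  embed-hom (suc zero) zero       = toℕ-injective (sym (trans (toℕ-+ₙ half zero)
    (trans (cong (_% n) (+-identityʳ (toℕ half))) (m<n⇒m%n≡m (toℕ<n half)))))
  embed-hom (suc zero) (suc zero) = toℕ-injective (sym (trans (toℕ-+ₙ half half)
    (trans (cong (λ u → (u + u) % n) toℕ-half) (n%n≡0 n))))

  H : Z2³Subgroup n
  H = record { φ = φ ; hom = hom ; inj = inj }
    where
    φ : Z2³ → G n
    φ (p , q , r) = p , q , embed r
    hom : ∀ x y → φ (x +Z2³ y) ≡ φ x +G φ y
    hom (p , q , r) (p′ , q′ , r′) = cong (λ u → p +ₙ p′ , q +ₙ q′ , u) (embed-hom r r′)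
    inj : Injective _≡_ _≡_ φ
    inj {_ , _ , zero}     {_ , _ , zero}     refl = refl
    inj {_ , _ , suc zero} {_ , _ , suc zero} refl = refl
    inj {_ , _ , zero}     {_ , _ , suc zero} ()
    inj {_ , _ , suc zero} {_ , _ , zero}     ()

  antipodal : ∀ {v} → v < n → v ≢ 0 → v ≢ h → halfRange v + halfRange (n ∸ v) ≡ 1
  antipodal {v} v<n v≢0 v≢h with <-cmp v h
  ... | tri< v<h _ _ = cong₂ _+_ (run-∈ h-1 (n≢0⇒n>0 v≢0) v<h)
                                 (run-∉ʳ h-1 (subst (_≤ n ∸ v) n∸h≡h (∸-monoʳ-≤ n (<⇒≤ v<h))))
  ... | tri≈ _ v≡h _ = contradiction v≡h v≢h
  ... | tri> _ _ h<v = cong₂ _+_ (run-∉ʳ h-1 (<⇒≤ h<v))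
                                 (run-∈ h-1 (m<n⇒0<n∸m v<n) (subst (n ∸ v <_) n∸h≡h (∸-monoʳ-< h<v (<⇒≤ v<n))))

  isDifferenceFamily : ∀ ts → (∀ c v → mult ts c v ≡ halfRange v) → IsDifferenceFamily H (map triple ts)
  isDifferenceFamily ts tiled = absent-on-H , once-off-H
    where
    count≡ : ∀ c z → count ⟨ c , z ⟩ (Δ (map triple ts)) ≡ halfRange (toℕ z) + halfRange (n ∸ toℕ z)
    count≡ c z = trans (count-Δ ts c z) (cong₂ _+_ (tiled c (toℕ z)) (tiled c (n ∸ toℕ z)))

    absent-on-H : ∀ g → g ∈H H → count g (Δ (map triple ts)) ≡ 0
    absent-on-H _ ((p , q , zero) , refl) =
      trans (count≡ (p , q) zero) (cong₂ _+_ (run-∉ˡ h-1 z<s) (run-∉ʳ h-1 (m≤m+n h h)))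
    absent-on-H _ ((p , q , suc zero) , refl) =
      trans (count≡ (p , q) half) (cong₂ _+_ (run-∉ʳ h-1 (≤-reflexive (sym toℕ-half)))
                                             (run-∉ʳ h-1 (≤-reflexive (sym (trans (cong (n ∸_) toℕ-half) n∸h≡h)))))

    once-off-H : ∀ g → ¬ g ∈H H → count g (Δ (map triple ts)) ≡ 1
    once-off-H (p , q , z) g∉H = trans (count≡ (p , q) z) (antipodal (toℕ<n z) z≢0 z≢h)
      where
      z≢0 : toℕ z ≢ 0
      z≢0 eq = g∉H ((p , q , zero) , cong (λ u → p , q , u) (toℕ-injective (sym eq)))
      z≢h : toℕ z ≢ h
      z≢h eq = g∉H ((p , q , suc zero) , cong (λ u → p , q , u) (toℕ-injective (trans toℕ-half (sym eq))))

module Construction (k : ℕ) where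
  open HalfTiling (3 + 3 * k)

  q₀ q₁ q₂ q₃ : Class
  q₀ = zero , zero
  q₁ = suc zero , zero
  q₂ = zero , suc zero
  q₃ = suc zero , suc zero

  family : (Q R : Class) (a b L r : ℕ) → 0 < a → L ≤ b → a + b + L + r ≡ 4 + 3 * k → Family n
  family Q R a b L r 0<a L≤b a+b+L+r≡h = record
    { Q = Q ; R = R ; a = a ; b = b ; L = L ; 0<a = 0<a ; L≤b = L≤b
    ; bounded = ≤-trans (m≤m+n (a + b + L) r) (≤-trans (≤-reflexive a+b+L+r≡h) (m≤m+n h h)) }

  families : List (Family n)
  families =
    family q₀ q₁ 2               k               k       (2 + k) z<s ≤-refl                  (solve (k ∷ [])) ∷
    family q₀ q₂ 1               (suc k + suc k) (suc k) 0       z<s (m≤m+n (suc k) (suc k)) (solve (k ∷ [])) ∷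
    family q₃ q₁ (3 + k)         k               k       1       z<s ≤-refl                  (solve (k ∷ [])) ∷
    family q₃ q₀ (2 + k)         (suc k)         (suc k) 0       z<s ≤-refl                  (solve (k ∷ [])) ∷
    family q₀ q₁ (suc k + suc k) (k + 1)         1       0       z<s (m≤n+m 1 k)             (solve (k ∷ [])) ∷
    family q₁ q₃ (suc k + suc k) (k + 1)         1       0       z<s (m≤n+m 1 k)             (solve (k ∷ [])) ∷ []

  tiling-q₀ : ∀ v → classSum q₀ (concatMap pieces families) v ≡ halfRange v
  tiling-q₀ v = begin
    classSum q₀ (concatMap pieces families) v
      ≡⟨ reorder x₁ x₂ y₄ x₅ ⟩
    x₁ + x₂ + x₅ + y₄
      ≡⟨ hits-interleave 1 k v ∪⟨ solve (k ∷ []) ⟩ hits-1 (λ i → suc k + suc k + 2 * i) v ∪⟨ solve (k ∷ []) ⟩ refl ⟩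
    run 1 (suc (2 * k) + 1 + suc k) v
      ≡⟨ cong (λ L → run 1 L v) (solve (k ∷ [])) ⟩
    halfRange v ∎
    where
    open ≡-Reasoning
    x₁ = hits (λ i → 2 + 2 * i) k v
    x₂ = hits (λ i → 1 + 2 * i) (suc k) v
    x₅ = hits (λ i → suc k + suc k + 2 * i) 1 v
    y₄ = run (2 + k + suc k) (suc k) v
    reorder : ∀ x₁ x₂ y₄ x₅ → x₁ + (x₂ + (y₄ + (x₅ + 0))) ≡ x₁ + x₂ + x₅ + y₄
    reorder = solve-∀

  tiling-q₁ : ∀ v → classSum q₁ (concatMap pieces families) v ≡ halfRange v
  tiling-q₁ v = begin
    classSum q₁ (concatMap pieces families) v
      ≡⟨ reorder y₁ d₁ y₃ y₅ d₅ x₆ ⟩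
    d₁ + d₅ + y₁ + x₆ + y₃ + y₅
      ≡⟨ hits-descending 0 k v ∪⟨ refl ⟩ hits-descending k 1 v ∪⟨ solve (k ∷ []) ⟩ refl
           ∪⟨ solve (k ∷ []) ⟩ hits-1 (λ i → suc k + suc k + 2 * i) v
           ∪⟨ solve (k ∷ []) ⟩ refl ∪⟨ solve (k ∷ []) ⟩ refl ⟩
    run 1 (k + 1 + k + 1 + k + 1) v
      ≡⟨ cong (λ L → run 1 L v) (solve (k ∷ [])) ⟩
    halfRange v ∎
    where
    open ≡-Reasoning
    y₁ = run (2 + k) k v
    d₁ = hits (k ∸_) k v
    y₃ = run (3 + k + k) k v
    y₅ = run (suc k + suc k + (k + 1)) 1 v
    d₅ = hits ((k + 1) ∸_) 1 v
    x₆ = hits (λ i → suc k + suc k + 2 * i) 1 v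
    reorder : ∀ y₁ d₁ y₃ y₅ d₅ x₆ →
      y₁ + (d₁ + (y₃ + (y₅ + (d₅ + (x₆ + 0))))) ≡ d₁ + d₅ + y₁ + x₆ + y₃ + y₅
    reorder = solve-∀

  tiling-q₂ : ∀ v → classSum q₂ (concatMap pieces families) v ≡ halfRange v
  tiling-q₂ v = begin
    classSum q₂ (concatMap pieces families) v
      ≡⟨ reorder y₂ d₂ d₃ d₆ ⟩
    d₃ + d₆ + d₂ + y₂
      ≡⟨ hits-descending 0 k v ∪⟨ refl ⟩ hits-descending k 1 v
           ∪⟨ solve (k ∷ []) ⟩ hits-descending (suc k) (suc k) v ∪⟨ solve (k ∷ []) ⟩ refl ⟩
    run 1 (k + 1 + suc k + suc k) v
      ≡⟨ cong (λ L → run 1 L v) (solve (k ∷ [])) ⟩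
    halfRange v ∎
    where
    open ≡-Reasoning
    y₂ = run (1 + (suc k + suc k)) (suc k) v
    d₂ = hits ((suc k + suc k) ∸_) (suc k) v
    d₃ = hits (k ∸_) k v
    d₆ = hits ((k + 1) ∸_) 1 v
    reorder : ∀ y₂ d₂ d₃ d₆ → y₂ + (d₂ + (d₃ + (d₆ + 0))) ≡ d₃ + d₆ + d₂ + y₂
    reorder = solve-∀

  tiling-q₃ : ∀ v → classSum q₃ (concatMap pieces families) v ≡ halfRange v
  tiling-q₃ v = begin
    classSum q₃ (concatMap pieces families) v
      ≡⟨ reorder x₃ x₄ d₄ y₆ ⟩
    d₄ + (x₃ + x₄) + y₆
      ≡⟨ hits-descending 0 (suc k) v ∪⟨ refl ⟩ hits-interleave (2 + k) k v ∪⟨ solve (k ∷ []) ⟩ refl ⟩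
    run 1 (suc k + suc (2 * k) + 1) v
      ≡⟨ cong (λ L → run 1 L v) (solve (k ∷ [])) ⟩
    halfRange v ∎
    where
    open ≡-Reasoning
    x₃ = hits (λ i → 3 + k + 2 * i) k v
    x₄ = hits (λ i → 2 + k + 2 * i) (suc k) v
    d₄ = hits (suc k ∸_) (suc k) v
    y₆ = run (suc k + suc k + (k + 1)) 1 v
    reorder : ∀ x₃ x₄ d₄ y₆ → x₃ + (x₄ + (d₄ + (y₆ + 0))) ≡ d₄ + (x₃ + x₄) + y₆
    reorder = solve-∀

  baseTriples : List (BaseTriple n)
  baseTriples = concatMap triples families

  tiling : ∀ c v → mult baseTriples c v ≡ halfRange v
  tiling c v = trans (mult-concatMap families c v) (tiling-class c v)
    where
    tiling-class : ∀ c v → classSum c (concatMap pieces families) v ≡ halfRange v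
    tiling-class (zero     , zero)     = tiling-q₀
    tiling-class (suc zero , zero)     = tiling-q₁
    tiling-class (zero     , suc zero) = tiling-q₂
    tiling-class (suc zero , suc zero) = tiling-q₃

  differenceFamily : HasDifferenceFamily n
  differenceFamily = H , map triple baseTriples , isDifferenceFamily baseTriples tiling

lemma3p4 : (d : ℕ) → d % 6 ≡ 5 →
    Σ (Z2³Subgroup (4 * d)) λ H → Σ (List (Triple (4 * d))) λ 𝒯 → IsDifferenceFamily H 𝒯
lemma3p4 d d%6≡5 = subst HasDifferenceFamily n≡4d (Construction.differenceFamily (4 * t + 2))
  where
  t = d / 6
  d≡5+t*6 : d ≡ 5 + t * 6
  d≡5+t*6 = trans (m≡m%n+[m/n]*n d 6) (cong (_+ t * 6) d%6≡5)
  n≡4[5+t*6] : ∀ t → (4 + 3 * (4 * t + 2)) + (4 + 3 * (4 * t + 2)) ≡ 4 * (5 + t * 6)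
  n≡4[5+t*6] = solve-∀
  n≡4d : (4 + 3 * (4 * t + 2)) + (4 + 3 * (4 * t + 2)) ≡ 4 * d
  n≡4d = trans (n≡4[5+t*6] t) (cong (4 *_) (sym d≡5+t*6))
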